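{- Let $\alpha\subseteq\{+,-\}$ with $\alpha\neq\emptyset$, $s\in\mathbb{N}$, $\mathcal{C}=\mathcal{C}_{\alpha,s}$, and let $F$ be a CNF formula. If $F$ has $\mathcal{C}$-backdoor depth at most some integer $d$, then every clause of $F$ contains at most $d+s$ $\alpha$-literals.
   Context: A clause is a finite set of literals with no complementary pair; a CNF formula is a finite set of clauses. For a partial assignment $\tau$, $F[\tau]$ is obtained by deleting clauses containing a true literal and deleting false literals from the remaining clauses. $\mathrm{Conn}(F)$ is the set of connected components of $F$ with respect to its incidence graph (bipartite graph between variables and clauses, $x$ adjacent to $c$ iff $x$ or $\neg x$ is in $c$). A literal is an $\alpha$-literal if it is positive and $+\in\alpha$, or negative and $-\in\alpha$; $\mathcal{C}_{\alpha,s}$ is the class of CNF formulas each clause of which has at most $s$ $\alpha$-literals. The $\mathcal{C}$-backdoor depth $\mathrm{depth}_{\mathcal{C}}(F)$ is $0$ if $F\in\mathcal{C}$; if $F\notin\mathcal{C}$ and $F$ is connected it is $1+\min_{x\in\mathit{var}(F)}\max_{\epsilon\in\{0,1\}}\mathrm{depth}_{\mathcal{C}}(F[x=\epsilon])$; otherwise it is $\max_{F'\in\mathrm{Conn}(F)}\mathrm{depth}_{\mathcal{C}}(F')$. -}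

module Defs where

open import Data.Nat using (ℕ; zero; suc; _≤_; _+_)
open import Data.Nat.Properties using (_≟_)
open import Data.Bool using (Bool; true; false; if_then_else_; not)
open import Data.Bool.Properties using () renaming (_≟_ to _≟ᵇ_)
open import Data.Product using (_×_; _,_; Σ; ∃)
open import Data.Sum using (_⊎_; inj₁; inj₂)
open import Data.List using (List; []; _∷_; filter; map; length)
open import Data.List.Membership.Propositional using (_∈_; _∉_)
open import Data.List.Relation.Unary.All using (All)
open import Data.List.Relation.Unary.Any using (Any)
open import Data.List.Relation.Unary.Unique.Propositional using (Unique)
open import Relation.Binary.PropositionalEquality using (_≡_; _≢_)
open import Relation.Nullary using (¬_; Dec; yes; no)
open import Relation.Unary using (Decidable)

-- A literal: a variable (a natural number) together with a polarity
-- (true = positive literal x, false = negative literal ¬x).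
record Literal : Set where
  constructor lit
  field
    var  : ℕ
    sign : Bool
open Literal public

-- A clause is a finite set of literals, represented as a list;
-- well-formedness (no repetitions, no complementary pair) is the
-- predicate WFClause below.
Clause : Set
Clause = List Literal

-- A CNF formula is a finite set of clauses, represented as a list.
-- (Repetitions of clauses are harmless: all notions below only use
-- list membership.)
CNF : Set
CNF = List Clause

complement : Literal → Literal
complement (lit x b) = lit x (not b)

WFClause : Clause → Set
WFClause c = Unique c × (∀ ℓ → ℓ ∈ c → complement ℓ ∉ c)

WFCNF : CNF → Set
WFCNF F = All WFClause F

OccursIn : ℕ → Clause → Set
OccursIn x c = Any (λ ℓ → var ℓ ≡ x) c

VarOf : CNF → ℕ → Set
VarOf F x = ∃ λ c → c ∈ F × OccursIn x c

TrueUnder : ℕ → Bool → Literal → Set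
TrueUnder x ε ℓ = (var ℓ ≡ x) × (sign ℓ ≡ ε)

trueUnder? : (x : ℕ) (ε : Bool) → Decidable (TrueUnder x ε)
trueUnder? x ε (lit y b) with y ≟ x | b ≟ᵇ ε
... | yes p | yes q = yes (p , q)
... | no ¬p | _     = no (λ { (p , _) → ¬p p })
... | yes _ | no ¬q = no (λ { (_ , q) → ¬q q })

Satisfied : ℕ → Bool → Clause → Set
Satisfied x ε c = Any (TrueUnder x ε) c

satisfied? : (x : ℕ) (ε : Bool) → Decidable (Satisfied x ε)
satisfied? x ε c = Data.List.Relation.Unary.Any.any? (trueUnder? x ε) c

notVar? : (x : ℕ) → Decidable (λ (ℓ : Literal) → var ℓ ≢ x)
notVar? x ℓ with var ℓ ≟ x
... | yes p = no (λ f → f p)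
... | no ¬p = yes ¬p

notSat? : (x : ℕ) (ε : Bool) → Decidable (λ c → ¬ Satisfied x ε c)
notSat? x ε c with satisfied? x ε c
... | yes p = no (λ f → f p)
... | no ¬p = yes ¬p

restrict : CNF → ℕ → Bool → CNF
restrict F x ε = map (filter (notVar? x)) (filter (notSat? x ε) F)

Vertex : Set
Vertex = ℕ ⊎ Clause

IsVertex : CNF → Vertex → Set
IsVertex F (inj₁ x) = VarOf F x
IsVertex F (inj₂ c) = c ∈ F

data Adj (F : CNF) : Vertex → Vertex → Set where
  vc : ∀ {x c} → c ∈ F → OccursIn x c → Adj F (inj₁ x) (inj₂ c)
  cv : ∀ {x c} → c ∈ F → OccursIn x c → Adj F (inj₂ c) (inj₁ x)

data Reach (F : CNF) : Vertex → Vertex → Set where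
  here : ∀ {u} → Reach F u u
  step : ∀ {u v w} → Adj F u v → Reach F v w → Reach F u w

Connected : CNF → Set
Connected F = ∀ u v → IsVertex F u → IsVertex F v → Reach F u v

-- F' (a set of clauses) is (the clause set of) a connected component of F:
-- a nonempty subformula of F that is connected and closed under
-- reachability in the incidence graph of F.
IsComponent : CNF → CNF → Set
IsComponent F' F =
  (∃ λ c → c ∈ F') ×
  (∀ c → c ∈ F' → c ∈ F) ×
  Connected F' ×
  (∀ c c' → c ∈ F' → c' ∈ F → Reach F (inj₂ c) (inj₂ c') → c' ∈ F')

-- α ⊆ {+,-} given by two booleans: (+ ∈ α, - ∈ α)
record Polarities : Set where
  constructor pol
  field
    plus  : Bool
    minus : Bool
open Polarities public

NonEmptyPol : Polarities → Set
NonEmptyPol α = (plus α ≡ true) ⊎ (minus α ≡ true)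

isαLit : Polarities → Literal → Bool
isαLit α ℓ = if sign ℓ then plus α else minus α

countα : Polarities → Clause → ℕ
countα α [] = zero
countα α (ℓ ∷ c) = if isαLit α ℓ then suc (countα α c) else countα α c

InC : Polarities → ℕ → CNF → Set
InC α s F = All (λ c → countα α c ≤ s) F

-- It follows the
-- recursive definition of backdoor depth clause by clause:
--  * depth 0 if F ∈ C;
--  * if F is connected: 1 + min_x max_ε depth(F[x=ε]);
--  * otherwise: max over the connected components.
data DepthAtMost (α : Polarities) (s : ℕ) : ℕ → CNF → Set where
  inClass : ∀ {d F} → InC α s F → DepthAtMost α s d F
  split   : ∀ {d F} (x : ℕ) →
            ¬ InC α s F → Connected F → VarOf F x →
            DepthAtMost α s d (restrict F x false) →
            DepthAtMost α s d (restrict F x true) →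
            DepthAtMost α s (suc d) F
  comps   : ∀ {d F} →
            ¬ InC α s F → ¬ Connected F →
            (∀ F' → IsComponent F' F → DepthAtMost α s d F') →
            DepthAtMost α s d F

{-# OPTIONS --safe #-}
module Submission where

-- A clause of F survives, minus its
-- literals on x, in F[x = ε] for some ε: it cannot be satisfied by both
-- x = 0 and x = 1, as it has no complementary pair. Being a set it has at
-- most one literal on x, so it loses at most one α-literal at each branching
-- step; at the leaves the class C_{α,s} bounds it by s. A clause also lies
-- in some connected component, which handles the third case.

open import Defs
open import Data.Nat using (ℕ; suc; _≤_; _+_; s≤s; z≤n; _≤?_; _≟_)
open import Data.Nat.Properties using (≤-trans; ≤-refl; m≤n+m; n≤1+n)
open import Data.Bool using (true; false; not)
open import Data.Bool.Properties using (¬-not) renaming (_≟_ to _≟ᵇ_)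
open import Data.Product using (_×_; _,_; ∃; proj₁; proj₂)
open import Data.Sum using (inj₁; inj₂)
open import Data.Empty using (⊥)
open import Data.List using (List; []; _∷_; filter)
open import Data.List.Membership.Propositional using (_∈_; find; lose)
open import Data.List.Membership.Propositional.Properties
  using (∈-filter⁺; ∈-filter⁻; ∈-map⁺)
open import Data.List.Properties using (filter-all)
open import Data.List.Relation.Unary.All as All using (All)
import Data.List.Relation.Unary.All.Properties as All
open import Data.List.Relation.Unary.Any using (here; there)
open import Data.List.Relation.Unary.AllPairs using (_∷_)
open import Data.List.Relation.Unary.Unique.Propositional using (Unique)
import Data.List.Relation.Unary.Unique.Propositional.Properties as Unique
open import Relation.Binary.PropositionalEquality using (_≡_; refl; sym; trans; subst)
open import Relation.Nullary using (¬_; Dec; yes; no)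
open import Relation.Nullary.Decidable using (decidable-stable; ¬¬-excluded-middle)
open import Relation.Nullary.Negation using (¬¬-map; contradiction)
open import Relation.Unary using (Decidable)

private
  variable
    A : Set

countα-∷-≤ : ∀ α ℓ c → countα α (ℓ ∷ c) ≤ suc (countα α c)
countα-∷-≤ α ℓ c with isαLit α ℓ
... | true  = ≤-refl
... | false = n≤1+n _

countα-∷-mono : ∀ α ℓ {c c′} → countα α c ≤ suc (countα α c′) →
  countα α (ℓ ∷ c) ≤ suc (countα α (ℓ ∷ c′))
countα-∷-mono α ℓ c≤c′ with isαLit α ℓ
... | true  = s≤s c≤c′
... | false = c≤c′

countα-delete-var : ∀ α x {m} c → Unique c → (∀ {ℓ} → ℓ ∈ c → var ℓ ≡ x → ℓ ≡ m) →
  countα α c ≤ suc (countα α (filter (notVar? x) c))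
countα-delete-var α x []      _           _   = z≤n
countα-delete-var α x (ℓ ∷ c) (ℓ∉c ∷ uc) onX with notVar? x ℓ
... | yes _    = countα-∷-mono α ℓ {c} {filter (notVar? x) c}
                   (countα-delete-var α x c uc (λ ℓ′∈c → onX (there ℓ′∈c)))
... | no ¬ℓ≢x  =
  subst (λ c′ → countα α (ℓ ∷ c) ≤ suc (countα α c′))
        (sym (filter-all (notVar? x) tailOffX)) (countα-∷-≤ α ℓ c)
  where
  ℓOnX : var ℓ ≡ x
  ℓOnX = decidable-stable (var ℓ ≟ x) ¬ℓ≢x
  tailOffX : All (λ ℓ′ → ¬ var ℓ′ ≡ x) c
  tailOffX = All.tabulate λ ℓ′∈c ℓ′OnX →
    All.lookup ℓ∉c ℓ′∈c (trans (onX (here refl) ℓOnX) (sym (onX (there ℓ′∈c) ℓ′OnX)))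

unsatisfied-var-literal : ∀ {x ε c ℓ} → ¬ Satisfied x ε c → ℓ ∈ c → var ℓ ≡ x →
  ℓ ≡ lit x (not ε)
unsatisfied-var-literal {ε = ε} {ℓ = lit y b} ¬sat ℓ∈c refl with b ≟ᵇ ε
... | yes b≡ε = contradiction (lose ℓ∈c (refl , b≡ε)) ¬sat
... | no  b≢ε = subst (λ b′ → lit y b ≡ lit y b′) (¬-not b≢ε) refl

unsatisfied-polarity : ∀ x {c} → WFClause c → ∃ λ ε → ¬ Satisfied x ε c
unsatisfied-polarity x {c} (_ , noCompl) with satisfied? x false c
... | no ¬sat₀ = false , ¬sat₀
... | yes sat₀ = true , λ sat₁ → clash (find sat₀) (find sat₁)
  where
  clash : ∃ (λ ℓ → ℓ ∈ c × TrueUnder x false ℓ) → ∃ (λ ℓ → ℓ ∈ c × TrueUnder x true ℓ) → ⊥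
  clash (lit y _ , ∈₀ , refl , refl) (lit _ _ , ∈₁ , refl , refl) = noCompl (lit y false) ∈₀ ∈₁

countα-≤-suc-restrict : ∀ α {F x ε c n} → c ∈ F → Unique c → ¬ Satisfied x ε c →
  (∀ {c′} → c′ ∈ restrict F x ε → countα α c′ ≤ n) → countα α c ≤ suc n
countα-≤-suc-restrict α {x = x} {ε} {c} c∈F uc ¬sat bound =
  ≤-trans (countα-delete-var α x c uc (unsatisfied-var-literal ¬sat))
          (s≤s (bound (∈-map⁺ (filter (notVar? x)) (∈-filter⁺ (notSat? x ε) c∈F ¬sat))))

filter-WFClause : ∀ {P : Literal → Set} (P? : Decidable P) {c} → WFClause c →
  WFClause (filter P? c)
filter-WFClause P? (uc , noCompl) =
  Unique.filter⁺ P? uc ,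
  λ ℓ ℓ∈ ℓ̄∈ → noCompl ℓ (proj₁ (∈-filter⁻ P? ℓ∈)) (proj₁ (∈-filter⁻ P? ℓ̄∈))

restrict-WFCNF : ∀ {F} x ε → WFCNF F → WFCNF (restrict F x ε)
restrict-WFCNF x ε wf =
  All.map⁺ (All.map (filter-WFClause (notVar? x)) (All.filter⁺ (notSat? x ε) wf))

reach-trans : ∀ {F u v w} → Reach F u v → Reach F v w → Reach F u w
reach-trans here       q = q
reach-trans (step a p) q = step a (reach-trans p q)

adj-sym : ∀ {F u v} → Adj F u v → Adj F v u
adj-sym (vc c∈F occ) = cv c∈F occ
adj-sym (cv c∈F occ) = vc c∈F occ

reach-sym : ∀ {F u v} → Reach F u v → Reach F v u
reach-sym here       = here
reach-sym (step a p) = reach-trans (reach-sym p) (step (adj-sym a) here)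

Selection : (A → Set) → List A → List A → Set
Selection P xs ys = (∀ {a} → a ∈ ys → a ∈ xs × P a) × (∀ {a} → a ∈ xs → P a → a ∈ ys)

selection-∷ : ∀ {P : A → Set} {x xs ys} → Dec (P x) → Selection P xs ys →
  ∃ (Selection P (x ∷ xs))
selection-∷ {P = P} {x} {xs} {ys} (yes px) (sound , complete) = x ∷ ys , sound′ , complete′
  where
  sound′ : ∀ {a} → a ∈ x ∷ ys → a ∈ x ∷ xs × P a
  sound′ = λ { (here refl) → here refl , px
             ; (there a∈ys) → there (proj₁ (sound a∈ys)) , proj₂ (sound a∈ys) }
  complete′ : ∀ {a} → a ∈ x ∷ xs → P a → a ∈ x ∷ ys
  complete′ = λ { (here refl) _ → here refl ; (there a∈xs) pa → there (complete a∈xs pa) }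
selection-∷ {P = P} {x} {xs} {ys} (no ¬px) (sound , complete) = ys , sound′ , complete′
  where
  sound′ : ∀ {a} → a ∈ ys → a ∈ x ∷ xs × P a
  sound′ = λ a∈ys → there (proj₁ (sound a∈ys)) , proj₂ (sound a∈ys)
  complete′ : ∀ {a} → a ∈ x ∷ xs → P a → a ∈ ys
  complete′ = λ { (here refl) px → contradiction px ¬px ; (there a∈xs) pa → complete a∈xs pa }

-- Membership of a reachability class is not decidable, so the class can
-- only be carved out of a list under double negation.
¬¬-selection : (P : A → Set) (xs : List A) → ¬ ¬ ∃ (Selection P xs)
¬¬-selection P []       k = k ([] , (λ ()) , (λ ()))
¬¬-selection P (x ∷ xs) k =
  ¬¬-selection P xs λ (_ , sel) → ¬¬-excluded-middle λ px? → k (selection-∷ px? sel)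

module _ {F F′ : CNF} {c : Clause}
         (sel : Selection (λ c′ → Reach F (inj₂ c) (inj₂ c′)) F F′) where

  private
    sound = proj₁ sel
    complete = proj₂ sel

  reach-within : ∀ {u v} → Reach F (inj₂ c) u → Reach F u v → Reach F′ u v
  reach-within r here = here
  reach-within r (step (vc {c = c₁} c₁∈F occ) p) =
    let r′ = reach-trans r (step (vc c₁∈F occ) here)
    in step (vc (complete c₁∈F r′) occ) (reach-within r′ p)
  reach-within r (step (cv {c = c₁} c₁∈F occ) p) =
    step (cv (complete c₁∈F r) occ) (reach-within (reach-trans r (step (cv c₁∈F occ) here)) p)

  reach-from-root : ∀ u → IsVertex F′ u → Reach F (inj₂ c) u
  reach-from-root (inj₁ x) (c₁ , c₁∈F′ , occ) =
    reach-trans (proj₂ (sound c₁∈F′)) (step (cv (proj₁ (sound c₁∈F′)) occ) here)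
  reach-from-root (inj₂ c₁) c₁∈F′ = proj₂ (sound c₁∈F′)

  reachable-isComponent : c ∈ F → IsComponent F′ F
  reachable-isComponent c∈F =
    (c , complete c∈F here) ,
    (λ _ c₁∈F′ → proj₁ (sound c₁∈F′)) ,
    (λ u v u∈ v∈ → let ru = reach-from-root u u∈ in
       reach-within ru (reach-trans (reach-sym ru) (reach-from-root v v∈))) ,
    (λ _ _ c₁∈F′ c′∈F r → complete c′∈F (reach-trans (proj₂ (sound c₁∈F′)) r))

¬¬-component : ∀ {F c} → c ∈ F → ¬ ¬ ∃ λ F′ → IsComponent F′ F × c ∈ F′
¬¬-component {F} {c} c∈F =
  ¬¬-map (λ (F′ , sel) → F′ , reachable-isComponent sel c∈F , proj₂ sel c∈F here)
         (¬¬-selection (λ c′ → Reach F (inj₂ c) (inj₂ c′)) F)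

countα-≤-depth+s : ∀ {α s d F} → DepthAtMost α s d F → WFCNF F →
  ∀ {c} → c ∈ F → countα α c ≤ d + s
countα-≤-depth+s {s = s} {d} (inClass F∈C) _ c∈F = ≤-trans (All.lookup F∈C c∈F) (m≤n+m s d)
countα-≤-depth+s {α} (split x _ _ _ D₀ D₁) wf c∈F
  with unsatisfied-polarity x (All.lookup wf c∈F)
... | false , ¬sat = countα-≤-suc-restrict α c∈F (proj₁ (All.lookup wf c∈F)) ¬sat
                       (countα-≤-depth+s D₀ (restrict-WFCNF x false wf))
... | true  , ¬sat = countα-≤-suc-restrict α c∈F (proj₁ (All.lookup wf c∈F)) ¬sat
                       (countα-≤-depth+s D₁ (restrict-WFCNF x true wf))
-- The component containing c exists only under double negation; the goal
-- is decidable, so that suffices.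
countα-≤-depth+s {α} {s} {d} (comps _ _ Dcomp) wf {c} c∈F =
  decidable-stable (countα α c ≤? d + s) (¬¬-map boundInComponent (¬¬-component c∈F))
  where
  boundInComponent : ∃ (λ F′ → IsComponent F′ _ × c ∈ F′) → countα α c ≤ d + s
  boundInComponent (F′ , isComp@(_ , F′⊆F , _) , c∈F′) =
    countα-≤-depth+s (Dcomp F′ isComp) (All.tabulate λ c₁∈F′ → All.lookup wf (F′⊆F _ c₁∈F′)) c∈F′

mainTheorem6 : (α : Polarities) → NonEmptyPol α → (s d : ℕ) → (F : CNF) →
    WFCNF F → DepthAtMost α s d F → All (λ c → countα α c ≤ d + s) F
mainTheorem6 α _ s d F wf D = All.tabulate (countα-≤-depth+s D wf)
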